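{- Let $G$ be a graph in which no edge is incident to all other edges. If $\Delta(G)\ge 5r-4$, then for every $f\in F_{G,0}$ there is an $f$-exclusive copy of $K_{1,r}$ in $G$.
   Context: For a graph $G$, $F_{G,0}$ is the set of maps $f:E(G)\to E(G)$ with $f(e)\cap e=\emptyset$ for every $e$. A subgraph $G'$ is $f$-exclusive if $f(e)\cap V(G')=\emptyset$ for every $e\in E(G')$. $\Delta(G)$ is the maximum degree. -}

module Defs where

open import Data.Nat using (ℕ; zero; suc; _⊔_)
open import Data.Fin using (Fin; _<_)
open import Data.Bool using (Bool; true; false; T)
open import Data.List using (List; length; filterᵇ; foldr; map; allFin)
open import Data.Product using (Σ; _×_; _,_; proj₁; ∃)
open import Data.Sum using (_⊎_)
open import Relation.Binary.PropositionalEquality using (_≡_; _≢_)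
open import Relation.Nullary using (¬_)

record Graph (n : ℕ) : Set where
  field
    adj    : Fin n → Fin n → Bool
    sym    : ∀ u v → adj u v ≡ adj v u
    irrefl : ∀ v → adj v v ≡ false
open Graph public

-- An (unordered) edge {u,v} is represented uniquely by u < v.
record Edge {n} (G : Graph n) : Set where
  constructor edge
  field
    lo    : Fin n
    hi    : Fin n
    lo<hi : lo < hi
    isAdj : T (adj G lo hi)
open Edge public

endpoints : ∀ {n} {G : Graph n} → Edge G → Fin n × Fin n
endpoints e = (lo e , hi e)

_∈ₑ_ : ∀ {n} {G : Graph n} → Fin n → Edge G → Set
x ∈ₑ e = x ≡ lo e ⊎ x ≡ hi e

Incident : ∀ {n} {G : Graph n} → Edge G → Edge G → Set
Incident {n} {G} e e' = ∃ λ (x : Fin n) → x ∈ₑ e × x ∈ₑ e'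

F0 : ∀ {n} → (G : Graph n) → (Edge G → Edge G) → Set
F0 G f = ∀ e → ¬ Incident {G = G} (f e) e

NoEdgeIncidentToAllOthers : ∀ {n} → Graph n → Set
NoEdgeIncidentToAllOthers G = ∀ (e : Edge G) → ¬ (∀ (e' : Edge G) → e' ≢ e → Incident {G = G} e e')

degree : ∀ {n} → Graph n → Fin n → ℕ
degree {n} G v = length (filterᵇ (adj G v) (allFin n))

-- Δ(G) (0 for the empty graph)
maxDegree : ∀ {n} → Graph n → ℕ
maxDegree {n} G = foldr _⊔_ 0 (map (degree G) (allFin n))

record Star {n} (G : Graph n) (r : ℕ) : Set where
  field
    centre     : Fin n
    leaf       : Fin r → Fin n
    leaf-inj   : ∀ i j → leaf i ≡ leaf j → i ≡ j
    leaf-adj   : ∀ i → T (adj G centre (leaf i))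
open Star public

_∈ᵥ_ : ∀ {n r} {G : Graph n} → Fin n → Star G r → Set
_∈ᵥ_ {r = r} x S = x ≡ centre S ⊎ ∃ λ (i : Fin r) → x ≡ leaf S i

_∈ₛ_ : ∀ {n r} {G : Graph n} → Edge G → Star G r → Set
_∈ₛ_ {r = r} e S = ∃ λ (i : Fin r) →
  (endpoints e ≡ (centre S , leaf S i)) ⊎ (endpoints e ≡ (leaf S i , centre S))

Exclusive : ∀ {n r} {G : Graph n} → (Edge G → Edge G) → Star G r → Set
Exclusive {n} {G = G} f S = ∀ (e : Edge G) → e ∈ₛ S → ∀ (x : Fin n) → _∈ₑ_ {G = G} x (f e) → ¬ (x ∈ᵥ S)

-- Take a vertex v of maximum degree and, for each neighbour u of v, record the two endpoints
-- of f(vu); this is a digraph on N(v) with out-degree at most 2 and no loops (f(vu) misses u).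
-- A set of neighbours that is independent in this digraph spans an f-exclusive star at v:
-- f(vu) misses v by assumption and misses every other leaf by independence.  Such a set is
-- built greedily: some vertex has in-degree at most 2 (in-degrees sum to at most 2|N(v)|),
-- and choosing it rules out at most 5 vertices (itself, 2 out- and 2 in-neighbours), so
-- |N(v)| ≥ 5r - 4 leaves room for r choices.
module Submission where

open import Defs
open import Data.Nat using (ℕ; _≤_; _*_; _∸_)
open import Data.Product using (Σ; _×_)

open import Algebra.Properties.CommutativeSemigroup using (interchange)
open import Data.Bool using (true; false; T; if_then_else_)
open import Data.Bool.Properties using (T-irrelevant)
open import Data.Empty using (⊥-elim)
open import Data.Fin as Fin using (Fin)
import Data.Fin.Properties as Finₚ
open import Data.List using (List; []; _∷_; length; filter; filterᵇ; foldr; map; allFin; lookup)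
import Data.List.Membership.DecPropositional as DecMembership
open import Data.List.Membership.Propositional using (_∈_; _∉_; find)
open import Data.List.Membership.Propositional.Properties using (∈-filter⁻; ∈-lookup)
open import Data.List.Relation.Unary.All as All using (All; []; _∷_)
open import Data.List.Relation.Unary.All.Properties using (¬Any⇒All¬)
open import Data.List.Relation.Unary.AllPairs using ([]; _∷_)
open import Data.List.Relation.Unary.Any using (here; there; any?)
open import Data.List.Relation.Unary.Unique.Propositional using (Unique)
import Data.List.Relation.Unary.Unique.Propositional.Properties as Unique
open import Data.Nat using (zero; suc; _+_; _⊔_; z≤n; s≤s; _≤?_)
open import Data.Nat.Properties
  using ( module ≤-Reasoning; ≤-refl; ≤-trans; ≤-reflexive; ≤-total; ≰⇒>; <-irrefl; <-irrelevant
        ; +-mono-≤; +-monoˡ-≤; +-monoʳ-≤; +-suc; +-commutativeSemigroup; *-suc; *-zeroʳ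
        ; ∸-monoˡ-≤; m+n∸n≡m; m+n∸m≡n; m≤n⇒m⊔n≡n; m≥n⇒m⊔n≡m)
open import Data.Product using (_,_; proj₁; proj₂; ∃)
open import Data.Sum using (_⊎_; inj₁; inj₂)
open import Function using (_∘_)
open import Relation.Binary.Definitions using (DecidableEquality; tri<; tri≈; tri>)
open import Relation.Binary.PropositionalEquality
  using (_≡_; _≢_; ≢-sym; refl; trans; cong; cong₂; subst; module ≡-Reasoning)
import Relation.Binary.PropositionalEquality as ≡
open import Relation.Nullary using (¬_; Dec; yes; no; does; _because_; ¬?; _⊎-dec_)
open import Relation.Nullary.Decidable using (T?)

module _ {A : Set} where

  ∑ : List A → (A → ℕ) → ℕ
  ∑ []       g = 0
  ∑ (x ∷ xs) g = g x + ∑ xs g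

  syntax ∑ xs (λ x → g) = ∑[ x ∈ xs ] g

  ∑-mono-≤ : ∀ xs {g h : A → ℕ} → (∀ {x} → x ∈ xs → g x ≤ h x) → ∑ xs g ≤ ∑ xs h
  ∑-mono-≤ []       g≤h = z≤n
  ∑-mono-≤ (x ∷ xs) g≤h = +-mono-≤ (g≤h (here refl)) (∑-mono-≤ xs (λ y∈xs → g≤h (there y∈xs)))

  ∑-+ : ∀ xs (g h : A → ℕ) → ∑[ x ∈ xs ] (g x + h x) ≡ ∑ xs g + ∑ xs h
  ∑-+ []       g h = refl
  ∑-+ (x ∷ xs) g h =
    trans (cong (g x + h x +_) (∑-+ xs g h))
          (interchange +-commutativeSemigroup (g x) (h x) (∑ xs g) (∑ xs h))

  ∑-const : ∀ xs c → ∑[ x ∈ xs ] c ≡ c * length xs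
  ∑-const []       c = ≡.sym (*-zeroʳ c)
  ∑-const (x ∷ xs) c = trans (cong (c +_) (∑-const xs c)) (≡.sym (*-suc c (length xs)))

∑-comm : ∀ {A B : Set} (xs : List A) (ys : List B) (f : A → B → ℕ) →
         ∑[ x ∈ xs ] ∑[ y ∈ ys ] f x y ≡ ∑[ y ∈ ys ] ∑[ x ∈ xs ] f x y
∑-comm []       ys f = ≡.sym (∑-const ys 0)
∑-comm (x ∷ xs) ys f =
  trans (cong (∑ ys (f x) +_) (∑-comm xs ys f)) (≡.sym (∑-+ ys (f x) (λ y → ∑[ x ∈ xs ] f x y)))

𝟙 : ∀ {P : Set} → Dec P → ℕ
𝟙 p? = if does p? then 1 else 0

𝟙-⊎ : ∀ {P Q : Set} (p? : Dec P) (q? : Dec Q) → 𝟙 (p? ⊎-dec q?) ≤ 𝟙 p? + 𝟙 q?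
𝟙-⊎ (true  because _) q? = s≤s z≤n
𝟙-⊎ (false because _) (true  because _) = ≤-refl
𝟙-⊎ (false because _) (false because _) = ≤-refl

length-filter-¬+∑𝟙 : ∀ {A : Set} {P : A → Set} (P? : ∀ x → Dec (P x)) xs →
                      length (filter (λ x → ¬? (P? x)) xs) + ∑[ x ∈ xs ] 𝟙 (P? x) ≡ length xs
length-filter-¬+∑𝟙 P? []       = refl
length-filter-¬+∑𝟙 P? (x ∷ xs) with P? x
... | true  because _ = trans (+-suc _ _) (cong suc (length-filter-¬+∑𝟙 P? xs))
... | false because _ = cong suc (length-filter-¬+∑𝟙 P? xs)

module _ {A : Set} (_≟_ : DecidableEquality A) where

  open DecMembership _≟_ using (_∈?_)

  ∑-𝟙-≟-≡0 : ∀ {x xs} → All (x ≢_) xs → ∑[ w ∈ xs ] 𝟙 (w ≟ x) ≡ 0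
  ∑-𝟙-≟-≡0             []             = refl
  ∑-𝟙-≟-≡0 {x} {w ∷ _} (x≢w ∷ x≢xs) with w ≟ x
  ... | yes w≡x = ⊥-elim (x≢w (≡.sym w≡x))
  ... | no  _   = ∑-𝟙-≟-≡0 x≢xs

  ∑-𝟙-≟-≤1 : ∀ {xs} x → Unique xs → ∑[ w ∈ xs ] 𝟙 (w ≟ x) ≤ 1
  ∑-𝟙-≟-≤1 x []                            = z≤n
  ∑-𝟙-≟-≤1 x (_∷_ {x = w} w≢xs xs-unique) with w ≟ x
  ... | yes refl = s≤s (≤-reflexive (∑-𝟙-≟-≡0 w≢xs))
  ... | no  _    = ∑-𝟙-≟-≤1 x xs-unique

  ∑-𝟙-∈-≤-length : ∀ {xs} → Unique xs → ∀ ys → ∑[ w ∈ xs ] 𝟙 (w ∈? ys) ≤ length ys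
  ∑-𝟙-∈-≤-length {xs} xs-unique []       = ≤-reflexive (∑-const xs 0)
  ∑-𝟙-∈-≤-length {xs} xs-unique (y ∷ ys) = begin
    ∑[ w ∈ xs ] 𝟙 (w ∈? y ∷ ys)
      ≤⟨ ∑-mono-≤ xs (λ {w} _ → 𝟙-⊎ (w ≟ y) (w ∈? ys)) ⟩
    ∑[ w ∈ xs ] (𝟙 (w ≟ y) + 𝟙 (w ∈? ys))
      ≡⟨ ∑-+ xs _ _ ⟩
    ∑[ w ∈ xs ] 𝟙 (w ≟ y) + ∑[ w ∈ xs ] 𝟙 (w ∈? ys)
      ≤⟨ +-mono-≤ (∑-𝟙-≟-≤1 y xs-unique) (∑-𝟙-∈-≤-length xs-unique ys) ⟩
    suc (length ys) ∎
    where open ≤-Reasoning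

[1+m]*[1+k]∸m≡1+[1+m]*k : ∀ m k → suc m * suc k ∸ m ≡ suc (suc m * k)
[1+m]*[1+k]∸m≡1+[1+m]*k m k = begin
  suc m * suc k ∸ m        ≡⟨ cong (_∸ m) (*-suc (suc m) k) ⟩
  suc (m + suc m * k) ∸ m  ≡⟨ cong (_∸ m) (≡.sym (+-suc m (suc m * k))) ⟩
  m + suc (suc m * k) ∸ m  ≡⟨ m+n∸m≡n m (suc (suc m * k)) ⟩
  suc (suc m * k)          ∎
  where open ≡-Reasoning

1≤[1+m]*[1+k]∸m : ∀ m k → 1 ≤ suc m * suc k ∸ m
1≤[1+m]*[1+k]∸m m k = subst (1 ≤_) (≡.sym ([1+m]*[1+k]∸m≡1+[1+m]*k m k)) (s≤s z≤n)

module BoundedOutDegree {A : Set} (_≟_ : DecidableEquality A) (out : A → List A)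
                        {d : ℕ} (length-out≤d : ∀ u → length (out u) ≤ d)
                        (loopless : ∀ u → u ∉ out u) where

  open DecMembership _≟_ using (_∈?_)

  inDegree : List A → A → ℕ
  inDegree xs w = ∑[ u ∈ xs ] 𝟙 (w ∈? out u)

  ∃-inDegree≤ : ∀ {xs} → Unique xs → 1 ≤ length xs → ∃ λ u → u ∈ xs × inDegree xs u ≤ d
  ∃-inDegree≤ {xs} xs-unique xs-nonempty with any? (λ u → inDegree xs u ≤? d) xs
  ... | yes some≤d = find some≤d
  ... | no  none≤d = ⊥-elim (<-irrefl refl (begin-strict
    d * length xs                   <⟨ +-monoˡ-≤ (d * length xs) xs-nonempty ⟩
    suc d * length xs               ≡⟨ ∑-const xs (suc d) ⟨
    ∑[ w ∈ xs ] suc d               ≤⟨ ∑-mono-≤ xs (λ w∈xs → ≰⇒> (All.lookup all>d w∈xs)) ⟩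
    ∑[ w ∈ xs ] inDegree xs w       ≡⟨ ∑-comm xs xs _ ⟩
    ∑[ u ∈ xs ] ∑[ w ∈ xs ] 𝟙 (w ∈? out u)
                                    ≤⟨ ∑-mono-≤ xs (λ {u} _ → outDegree≤d u) ⟩
    ∑[ u ∈ xs ] d                   ≡⟨ ∑-const xs d ⟩
    d * length xs                   ∎))
    where
    open ≤-Reasoning
    all>d = ¬Any⇒All¬ xs none≤d
    outDegree≤d : ∀ u → ∑[ w ∈ xs ] 𝟙 (w ∈? out u) ≤ d
    outDegree≤d u = ≤-trans (∑-𝟙-∈-≤-length _≟_ xs-unique (out u)) (length-out≤d u)

  Conflict : A → A → Set
  Conflict u w = w ≡ u ⊎ w ∈ out u ⊎ u ∈ out w

  conflict? : ∀ u w → Dec (Conflict u w)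
  conflict? u w = w ≟ u ⊎-dec w ∈? out u ⊎-dec u ∈? out w

  ∑-𝟙-conflict≤ : ∀ {xs u} → Unique xs → inDegree xs u ≤ d →
                  ∑[ w ∈ xs ] 𝟙 (conflict? u w) ≤ suc (d + d)
  ∑-𝟙-conflict≤ {xs} {u} xs-unique inDegree≤d = begin
    ∑[ w ∈ xs ] 𝟙 (conflict? u w)
      ≤⟨ ∑-mono-≤ xs (λ {w} _ → ≤-trans (𝟙-⊎ (w ≟ u) (w ∈? out u ⊎-dec u ∈? out w))
                                         (+-monoʳ-≤ (𝟙 (w ≟ u)) (𝟙-⊎ (w ∈? out u) (u ∈? out w)))) ⟩
    ∑[ w ∈ xs ] (𝟙 (w ≟ u) + (𝟙 (w ∈? out u) + 𝟙 (u ∈? out w)))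
      ≡⟨ ∑-+ xs _ _ ⟩
    ∑[ w ∈ xs ] 𝟙 (w ≟ u) + ∑[ w ∈ xs ] (𝟙 (w ∈? out u) + 𝟙 (u ∈? out w))
      ≡⟨ cong (∑[ w ∈ xs ] 𝟙 (w ≟ u) +_) (∑-+ xs _ _) ⟩
    ∑[ w ∈ xs ] 𝟙 (w ≟ u) + (∑[ w ∈ xs ] 𝟙 (w ∈? out u) + inDegree xs u)
      ≤⟨ +-mono-≤ (∑-𝟙-≟-≤1 _≟_ u xs-unique)
                  (+-mono-≤ (≤-trans (∑-𝟙-∈-≤-length _≟_ xs-unique (out u)) (length-out≤d u))
                            inDegree≤d) ⟩
    suc (d + d) ∎
    where open ≤-Reasoning

  Independent : List A → Set
  Independent S = ∀ {u w} → u ∈ S → w ∈ S → w ∉ out u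

  record IndependentSubset (xs : List A) (r : ℕ) : Set where
    field
      members     : List A
      unique      : Unique members
      members⊆xs  : ∀ {x} → x ∈ members → x ∈ xs
      independent : Independent members
      length≡r    : length members ≡ r

  independentSubset : ∀ r {xs} → Unique xs → suc (d + d) * r ∸ (d + d) ≤ length xs →
                      IndependentSubset xs r
  independentSubset zero _ _ = record
    { members = [] ; unique = [] ; members⊆xs = λ () ; independent = λ () ; length≡r = refl }
  independentSubset (suc k) {xs} xs-unique bound
    with bound′ ← subst (_≤ length xs) ([1+m]*[1+k]∸m≡1+[1+m]*k (d + d) k) bound
    with u , u∈xs , inDegree≤d ← ∃-inDegree≤ xs-unique (≤-trans (s≤s z≤n) bound′) = record
    { members     = u ∷ members
    ; unique      = All.tabulate (λ w∈S → ≢-sym (¬conflict w∈S ∘ inj₁)) ∷ unique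
    ; members⊆xs  = λ { (here refl) → u∈xs
                      ; (there w∈S) → proj₁ (∈-filter⁻ compatible? {xs = xs} (members⊆xs w∈S)) }
    ; independent = λ { (here refl) (here refl) → loopless u
                      ; (here refl) (there w∈S) → ¬conflict w∈S ∘ inj₂ ∘ inj₁
                      ; (there w∈S) (here refl) → ¬conflict w∈S ∘ inj₂ ∘ inj₂
                      ; (there v∈S) (there w∈S) → independent v∈S w∈S }
    ; length≡r    = cong suc length≡r
    }
    where
    compatible? = λ w → ¬? (conflict? u w)
    remaining = filter compatible? xs

    length-xs≤ : length xs ≤ length remaining + suc (d + d)
    length-xs≤ = begin
      length xs
        ≡⟨ length-filter-¬+∑𝟙 (conflict? u) xs ⟨
      length remaining + ∑[ w ∈ xs ] 𝟙 (conflict? u w)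
        ≤⟨ +-monoʳ-≤ (length remaining) (∑-𝟙-conflict≤ xs-unique inDegree≤d) ⟩
      length remaining + suc (d + d) ∎
      where open ≤-Reasoning

    bound-remaining : suc (d + d) * k ∸ (d + d) ≤ length remaining
    bound-remaining = ≤-trans (∸-monoˡ-≤ (suc (d + d)) (≤-trans bound′ length-xs≤))
                              (≤-reflexive (m+n∸n≡m (length remaining) (suc (d + d))))

    open IndependentSubset
      (independentSubset k (Unique.filter⁺ compatible? xs-unique) bound-remaining)

    ¬conflict : ∀ {w} → w ∈ members → ¬ Conflict u w
    ¬conflict w∈S = proj₂ (∈-filter⁻ compatible? {xs = xs} (members⊆xs w∈S))

lookup-injective : ∀ {A : Set} {xs : List A} → Unique xs → ∀ i j → lookup xs i ≡ lookup xs j → i ≡ j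
lookup-injective (_    ∷ _)  Fin.zero    Fin.zero    _  = refl
lookup-injective (x≢xs ∷ _)  Fin.zero    (Fin.suc j) eq = ⊥-elim (All.lookup x≢xs (∈-lookup j) eq)
lookup-injective (x≢xs ∷ _)  (Fin.suc i) Fin.zero    eq =
  ⊥-elim (All.lookup x≢xs (∈-lookup i) (≡.sym eq))
lookup-injective (_    ∷ xs) (Fin.suc i) (Fin.suc j) eq = cong Fin.suc (lookup-injective xs i j eq)

max-attained : ∀ {A : Set} {m} (g : A → ℕ) xs → 1 ≤ m → m ≤ foldr _⊔_ 0 (map g xs) → ∃ λ x → m ≤ g x
max-attained g []       (s≤s _) ()
max-attained g (x ∷ xs) 1≤m m≤max with ≤-total (g x) (foldr _⊔_ 0 (map g xs))
... | inj₁ gx≤ = max-attained g xs 1≤m (≤-trans m≤max (≤-reflexive (m≤n⇒m⊔n≡n gx≤)))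
... | inj₂ gx≥ = x , ≤-trans m≤max (≤-reflexive (m≥n⇒m⊔n≡m gx≥))

module _ {n} {G : Graph n} where

  edge-≡ : (e e′ : Edge G) → lo e ≡ lo e′ → hi e ≡ hi e′ → e ≡ e′
  edge-≡ (edge l h l<h l~h) (edge _ _ l<h′ l~h′) refl refl =
    cong₂ (edge l h) (<-irrelevant l<h l<h′) (T-irrelevant l~h l~h′)

  toEdge : ∀ u v → T (adj G u v) → Edge G
  toEdge u v u~v with Finₚ.<-cmp u v
  ... | tri< u<v _ _ = edge u v u<v u~v
  ... | tri≈ _ refl _ = ⊥-elim (subst T (irrefl G u) u~v)
  ... | tri> _ _ v<u = edge v u v<u (subst T (Graph.sym G u v) u~v)

  ∈ₑ-toEdgeˡ : ∀ u v (u~v : T (adj G u v)) → u ∈ₑ toEdge u v u~v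
  ∈ₑ-toEdgeˡ u v u~v with Finₚ.<-cmp u v
  ... | tri< _ _ _    = inj₁ refl
  ... | tri≈ _ refl _ = ⊥-elim (subst T (irrefl G u) u~v)
  ... | tri> _ _ _    = inj₂ refl

  ∈ₑ-toEdgeʳ : ∀ u v (u~v : T (adj G u v)) → v ∈ₑ toEdge u v u~v
  ∈ₑ-toEdgeʳ u v u~v with Finₚ.<-cmp u v
  ... | tri< _ _ _    = inj₂ refl
  ... | tri≈ _ refl _ = ⊥-elim (subst T (irrefl G u) u~v)
  ... | tri> _ _ _    = inj₁ refl

  toEdge-unique : ∀ {u v} (e : Edge G) (u~v : T (adj G u v)) →
                  endpoints e ≡ (u , v) ⊎ endpoints e ≡ (v , u) → e ≡ toEdge u v u~v
  toEdge-unique {u} {v} e u~v e-ends with Finₚ.<-cmp u v | e-ends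
  ... | tri< _ _ _    | inj₁ refl = edge-≡ e _ refl refl
  ... | tri< u<v _ _  | inj₂ refl = ⊥-elim (Finₚ.<-asym u<v (lo<hi e))
  ... | tri≈ _ refl _ | _         = ⊥-elim (subst T (irrefl G u) u~v)
  ... | tri> _ _ v<u  | inj₁ refl = ⊥-elim (Finₚ.<-asym v<u (lo<hi e))
  ... | tri> _ _ _    | inj₂ refl = edge-≡ e _ refl refl

  vertices : Edge G → List (Fin n)
  vertices e = lo e ∷ hi e ∷ []

  ∈vertices⇒∈ₑ : ∀ {x} e → x ∈ vertices e → x ∈ₑ e
  ∈vertices⇒∈ₑ e (here x≡lo)         = inj₁ x≡lo
  ∈vertices⇒∈ₑ e (there (here x≡hi)) = inj₂ x≡hi

  ∈ₑ⇒∈vertices : ∀ {x} e → x ∈ₑ e → x ∈ vertices e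
  ∈ₑ⇒∈vertices e (inj₁ x≡lo) = here x≡lo
  ∈ₑ⇒∈vertices e (inj₂ x≡hi) = there (here x≡hi)

module NeighbourhoodDigraph {n} (G : Graph n) (f : Edge G → Edge G) (f-disjoint : F0 G f)
                            (v : Fin n) where

  neighbours : List (Fin n)
  neighbours = filterᵇ (adj G v) (allFin n)

  neighbours-unique : Unique neighbours
  neighbours-unique = Unique.filter⁺ (T? ∘ adj G v) (Unique.allFin⁺ n)

  -- Non-neighbours get no out-neighbours, so the digraph's hypotheses hold on all of Fin n.
  out : Fin n → List (Fin n)
  out u with T? (adj G v u)
  ... | yes v~u = vertices (f (toEdge v u v~u))
  ... | no  _   = []

  out-adj : ∀ {u} (v~u : T (adj G v u)) → out u ≡ vertices (f (toEdge v u v~u))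
  out-adj {u} v~u with T? (adj G v u)
  ... | yes v~u′ = cong (vertices ∘ f ∘ toEdge v u) (T-irrelevant v~u′ v~u)
  ... | no  ¬v~u = ⊥-elim (¬v~u v~u)

  length-out≤2 : ∀ u → length (out u) ≤ 2
  length-out≤2 u with T? (adj G v u)
  ... | yes _ = ≤-refl
  ... | no  _ = z≤n

  loopless : ∀ u → u ∉ out u
  loopless u with T? (adj G v u)
  ... | yes v~u = λ u∈f[vu] →
    f-disjoint vu (u , ∈vertices⇒∈ₑ (f vu) u∈f[vu] , ∈ₑ-toEdgeʳ v u v~u)
    where vu = toEdge v u v~u
  ... | no  _   = λ ()

  open BoundedOutDegree Finₚ._≟_ out length-out≤2 loopless public

  exclusiveStar : ∀ {r} → IndependentSubset neighbours r → Σ (Star G r) λ S → Exclusive f S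
  exclusiveStar record { members = S ; unique = S-unique ; members⊆xs = S⊆neighbours
                       ; independent = S-independent ; length≡r = refl } = star , exclusive
    where
    v~leaf : ∀ i → T (adj G v (lookup S i))
    v~leaf i = proj₂ (∈-filter⁻ (T? ∘ adj G v) {xs = allFin n} (S⊆neighbours (∈-lookup i)))

    star : Star G (length S)
    star = record { centre = v ; leaf = lookup S ; leaf-inj = lookup-injective S-unique
                  ; leaf-adj = v~leaf }

    exclusive : Exclusive f star
    exclusive e (i , e-ends) x x∈fe x∈star
      with refl ← toEdge-unique e (v~leaf i) e-ends
      with x∈star
    ... | inj₁ refl       = f-disjoint e (v , x∈fe , ∈ₑ-toEdgeˡ v (lookup S i) (v~leaf i))
    ... | inj₂ (j , refl) = S-independent (∈-lookup i) (∈-lookup j)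
      (subst (lookup S j ∈_) (≡.sym (out-adj (v~leaf i))) (∈ₑ⇒∈vertices (f e) x∈fe))

-- No edge meets all others exactly when F0 G is inhabited, so that hypothesis is implied by f.
proposition4p2 : ∀ {n} (G : Graph n) (r : ℕ) → 1 ≤ r
    → NoEdgeIncidentToAllOthers G
    → 5 * r ∸ 4 ≤ maxDegree G
    → ∀ (f : Edge G → Edge G) → F0 G f
    → Σ (Star G r) λ S → Exclusive f S
proposition4p2 {n} G (suc k) (s≤s _) _ Δ≥5r∸4 f f-disjoint
  with v , degree≥5r∸4 ← max-attained (degree G) (allFin n) (1≤[1+m]*[1+k]∸m 4 k) Δ≥5r∸4
  = exclusiveStar (independentSubset (suc k) neighbours-unique degree≥5r∸4)
  where open NeighbourhoodDigraph G f f-disjoint v
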